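{- Let $\mathcal{F}$ be a nice family of graphs. For any $\varepsilon>0$ there exists $\Delta_\varepsilon$ such that every graph $G\in\mathcal{F}$ of maximum degree $\Delta\ge\Delta_\varepsilon$ contains at least one of the following: (A) a removable vertex $v$ which has degree less than $\frac32\Delta+\Delta^{1/2}$ in $G^2$; or (B) a removable copy of $H^*$ with core $R$, for some multigraph $H$ which contains at least one edge, such that for every set $X$ of vertices of $H$, the sum over the vertices of $G$ corresponding to $X$ of their degrees in $G-R$ exceeds the number of edges of $H$ with exactly one end in $X$ by at most $|X|\,\Delta^{9/10}$.
   Context: Graphs are finite, simple and loopless; multigraphs may have multiple edges but no loops. $G^2$ is the square of $G$. A vertex $v$ of $G$ is removable if it has at most $\Delta^{1/4}$ neighbours in $G$ and at most two of its neighbours have degree at least $\Delta^{1/4}$ in $G$. For a multigraph $H$, $H^*$ is the graph obtained by subdividing each edge of $H$ exactly once; the set of subdivision vertices (one for each edge of $H$) is the core of $H^*$. A removable copy of $H^*$ in $G$ is a subgraph of $G$ isomorphic to $H^*$ such that the vertices of $G$ corresponding to the core are removable and each vertex of $G$ corresponding to a vertex of $H$ has degree at least $\Delta^{1/4}$ in $G$; its core $R$ is the set of vertices of $G$ corresponding to the core of $H^*$. For $U,W\subseteq V(G)$, $e(U,W)$ counts edges $uw$ with $u\in U$, $w\in W$ (edges with both ends in $U\cap W$ counted twice). A family $\mathcal{F}$ is nice if it is closed under taking minors and there is a constant $\beta_{\mathcal{F}}$ such that for every $G\in\mathcal{F}$ and $B\subseteq V(G)$, the set $A$ of vertices of $V(G)\setminus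 B$ with at least three neighbours in $B$ satisfies $e(A,B)\le\beta_{\mathcal{F}}|B|$. -}

module Defs where

open import Data.Nat using (ℕ; zero; suc; _+_; _*_; _∸_; _^_; _≤_; _<_; _⊔_; _≤?_)
open import Data.Bool using (Bool; true; false; if_then_else_; _∧_; _∨_; not; _xor_)
open import Data.Fin using (Fin; zero; suc; _≟_)
open import Data.Maybe using (Maybe; just)
open import Data.Product using (Σ; ∃; ∃-syntax; _×_; _,_; proj₁; proj₂)
open import Data.Sum using (_⊎_)
open import Relation.Nullary using (¬_)
open import Relation.Nullary.Decidable using (⌊_⌋)
open import Relation.Binary.PropositionalEquality using (_≡_)

sumFin : ∀ {k} → (Fin k → ℕ) → ℕ
sumFin {zero}  f = 0
sumFin {suc k} f = f zero + sumFin (λ i → f (suc i))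

count : ∀ {k} → (Fin k → Bool) → ℕ
count p = sumFin (λ i → if p i then 1 else 0)

anyFin : ∀ {k} → (Fin k → Bool) → Bool
anyFin {zero}  p = false
anyFin {suc k} p = p zero ∨ anyFin (λ i → p (suc i))

maxFin : ∀ {k} → (Fin k → ℕ) → ℕ
maxFin {zero}  f = 0
maxFin {suc k} f = f zero ⊔ maxFin (λ i → f (suc i))

record Graph : Set where
  field
    n      : ℕ
    adj    : Fin n → Fin n → Bool
    sym    : ∀ u v → adj u v ≡ adj v u
    irrefl : ∀ v → adj v v ≡ false

open Graph public

V : Graph → Set
V G = Fin (n G)

deg : (G : Graph) → V G → ℕ
deg G v = count (adj G v)

maxDeg : Graph → ℕ
maxDeg G = maxFin (deg G)

adj² : (G : Graph) → V G → V G → Bool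
adj² G u v = not ⌊ u ≟ v ⌋ ∧ (adj G u v ∨ anyFin (λ w → adj G u w ∧ adj G w v))

deg² : (G : Graph) → V G → ℕ
deg² G v = count (adj² G v)

-- Removable vertices  (Δ = maxDeg G;  x ≤ Δ^{1/4} ⇔ x^4 ≤ Δ)

bigB : (G : Graph) → V G → Bool
bigB G u = ⌊ maxDeg G ≤? deg G u ^ 4 ⌋

Removable : (G : Graph) → V G → Set
Removable G v =
  (deg G v ^ 4 ≤ maxDeg G) × (count (λ u → adj G v u ∧ bigB G u) ≤ 2)

-- d < (3/2)Δ + Δ^{1/2}   ⇔   2d < 3Δ  or  (2d - 3Δ)² < 4Δ
LtThreeHalvesPlusSqrt : ℕ → ℕ → Set
LtThreeHalvesPlusSqrt d Δ = (2 * d < 3 * Δ) ⊎ ((2 * d ∸ 3 * Δ) ^ 2 < 4 * Δ)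

record Multigraph : Set where
  field
    k      : ℕ
    m      : ℕ
    ends   : Fin m → Fin k × Fin k
    noLoop : ∀ e → ¬ (proj₁ (ends e) ≡ proj₂ (ends e))

open Multigraph public

-- A removable copy of H* in G: vertex e of the core (subdivision vertex
-- of edge e) is mapped to ψ e, vertex a of H to φ a; the map is injective
-- and every edge of H* goes to an edge of G.
record RemovableCopy (G : Graph) (H : Multigraph) : Set where
  field
    φ        : Fin (k H) → V G
    ψ        : Fin (m H) → V G
    φ-inj    : ∀ a b → φ a ≡ φ b → a ≡ b
    ψ-inj    : ∀ e f → ψ e ≡ ψ f → e ≡ f
    disjoint : ∀ a e → ¬ (φ a ≡ ψ e)
    edge₁    : ∀ e → adj G (ψ e) (φ (proj₁ (ends H e))) ≡ true
    edge₂    : ∀ e → adj G (ψ e) (φ (proj₂ (ends H e))) ≡ true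
    coreRem  : ∀ e → Removable G (ψ e)
    branchBig : ∀ a → maxDeg G ≤ deg G (φ a) ^ 4

open RemovableCopy public

inCore : ∀ {G H} → RemovableCopy G H → V G → Bool
inCore {G} c w = anyFin (λ e → ⌊ ψ c e ≟ w ⌋)

degMinusCore : ∀ {G H} → RemovableCopy G H → V G → ℕ
degMinusCore {G} c u = count (λ w → adj G u w ∧ not (inCore c w))

boundary : (H : Multigraph) → (Fin (k H) → Bool) → ℕ
boundary H X = count (λ e → X (proj₁ (ends H e)) xor X (proj₂ (ends H e)))

-- Σ_{x ∈ X} deg_{G-R}(φ x)  -  |∂X|  ≤  |X| Δ^{9/10}
-- ⇔ (Σ ∸ |∂X|)^10 ≤ |X|^10 Δ^9
GoodCopy : (G : Graph) (H : Multigraph) → RemovableCopy G H → Set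
GoodCopy G H c =
  ∀ (X : Fin (k H) → Bool) →
    (sumFin (λ a → if X a then degMinusCore c (φ c a) else 0) ∸ boundary H X) ^ 10
      ≤ count X ^ 10 * maxDeg G ^ 9

OutcomeA : Graph → Set
OutcomeA G = Σ (V G) λ v → Removable G v × LtThreeHalvesPlusSqrt (deg² G v) (maxDeg G)

OutcomeB : Graph → Set
OutcomeB G = Σ Multigraph λ H → (1 ≤ m H) × Σ (RemovableCopy G H) λ c → GoodCopy G H c

data Walk (G : Graph) (P : V G → Set) : V G → V G → Set where
  here : ∀ {u} → Walk G P u u
  step : ∀ {u w v} → adj G u w ≡ true → P w → Walk G P w v → Walk G P u v

-- H is a minor of G: disjoint nonempty connected branch sets B_i
-- (branch u ≡ just i), with an edge of G between B_i and B_j whenever ij ∈ E(H)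
record Minor (H G : Graph) : Set where
  field
    branch    : V G → Maybe (V H)
    nonempty  : ∀ i → ∃[ u ] (branch u ≡ just i)
    connected : ∀ i u v → branch u ≡ just i → branch v ≡ just i →
                Walk G (λ w → branch w ≡ just i) u v
    edges     : ∀ i j → adj H i j ≡ true →
                ∃[ u ] ∃[ v ] (branch u ≡ just i × branch v ≡ just j × adj G u v ≡ true)

-- e(A,B) where A = vertices outside B with ≥ 3 neighbours in B
nbrsIn : (G : Graph) → (V G → Bool) → V G → ℕ
nbrsIn G B a = count (λ b → adj G a b ∧ B b)

eAB : (G : Graph) → (V G → Bool) → ℕ
eAB G B = sumFin (λ a → if not (B a) ∧ ⌊ 3 ≤? nbrsIn G B a ⌋ then nbrsIn G B a else 0)

record Nice (F : Graph → Set) : Set where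
  field
    minorClosed : ∀ G H → F G → Minor H G → F H
    β           : ℕ
    bound       : ∀ G → F G → (B : V G → Bool) → eAB G B ≤ β * count B

module Submission where

-- Call a vertex big if its degree is at least Δ^{1/4}. A small vertex with at most one big
-- neighbour is removable and has at most Δ^{1/4} + Δ + Δ^{1/2} < 3Δ/2 vertices within distance two,
-- which is (A). Otherwise every small vertex has at least two big neighbours. For a set Y of big
-- vertices, the small vertices with exactly two big neighbours, both in Y, subdivide the edges of
-- a multigraph H_Y on Y, and form the core R_Y of a removable copy of H_Y*. Put
-- Φ(Y) = Σ_{v ∈ Y} deg_{G - R_Y}(v) + θ |big ∖ Y|. Niceness, applied to both sides of a locally
-- maximal cut, bounds the edges among big vertices and the edges from big vertices to small vertices
-- with three or more big neighbours by O(β)|big|, so Φ(big) < θ |big| for θ = 5β + 9. A set X ⊆ Y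
-- violating (B) has Σ_X deg_{G - R_Y} - |∂X| > |X| Δ^{9/10} ≥ θ |X|, and then Φ(Y ∖ X) < Φ(Y).
-- Descending from Y = big therefore ends in (B), and Φ(Y) < θ |big| forces H_Y to have an edge.

open import Defs
open import Data.Nat using (ℕ; _≤_)
open import Data.Rational using (ℚ; 0ℚ; _<_)
open import Data.Product using (∃-syntax)
open import Data.Sum using (_⊎_)

open import Data.Bool using (Bool; true; false; if_then_else_; _∧_; _∨_; not; _xor_)
import Data.Bool.Properties as Boolₚ
open import Data.Bool.Properties
  using ( ∧-assoc; ∧-conicalˡ; ∧-conicalʳ; ∧-identityʳ; ∧-zeroʳ; ∧-inverseʳ; ∨-zeroʳ
        ; not-injective; not-involutive; not-distribʳ-xor; xor-comm; xor-identityʳ; true-xor; T-≡)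
open import Data.Fin using (Fin; zero; suc; _≟_)
import Data.Fin.Properties as Finₚ
open import Data.Fin.Subset.Properties using (anySubset?)
open import Data.Vec using (lookup; tabulate)
open import Data.Vec.Properties using (lookup∘tabulate)
open import Data.Nat as ℕ using (suc; _+_; _*_; _∸_; _^_; z≤n; s≤s; z<s; _≤?_; _<?_; >-nonZero)
open import Data.Nat.Properties hiding (_≟_)
open import Data.Nat.Tactic.RingSolver using (solve-∀)
open import Algebra.Properties.CommutativeSemigroup +-commutativeSemigroup
  using (interchange; x∙yz≈y∙xz)
open import Data.Product using (Σ; _×_; _,_; proj₁; proj₂)
open import Data.Sum using (inj₁; inj₂; [_,_]′)
open import Relation.Binary.PropositionalEquality as ≡
  using (_≡_; _≢_; refl; trans; cong; cong₂; subst; subst₂; module ≡-Reasoning)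
open import Relation.Nullary using (¬_; Dec; yes; no; contradiction; _×-dec_)
open import Relation.Nullary.Decidable using (⌊_⌋; ¬?; decidable-stable; toWitness; isYes≗does; dec-true)
open import Function.Bundles using (Equivalence)

when : Bool → ℕ → ℕ
when b x = if b then x else 0

when-0 : ∀ b → when b 0 ≡ 0
when-0 true  = refl
when-0 false = refl

χ : Bool → ℕ
χ b = if b then 1 else 0

χ-∧ˡ : ∀ a b → χ (a ∧ b) ≡ when a (χ b)
χ-∧ˡ true  b = refl
χ-∧ˡ false b = refl

χ-∧ʳ : ∀ a b → χ (a ∧ b) ≡ when b (χ a)
χ-∧ʳ true  b     = refl
χ-∧ʳ false true  = refl
χ-∧ʳ false false = refl

sumFin-cong : ∀ {k} {f g : Fin k → ℕ} → (∀ i → f i ≡ g i) → sumFin f ≡ sumFin g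
sumFin-cong {ℕ.zero} f≗g = refl
sumFin-cong {suc k}  f≗g = cong₂ _+_ (f≗g zero) (sumFin-cong (λ i → f≗g (suc i)))

sumFin-mono : ∀ {k} {f g : Fin k → ℕ} → (∀ i → f i ≤ g i) → sumFin f ≤ sumFin g
sumFin-mono {ℕ.zero} f≤g = z≤n
sumFin-mono {suc k}  f≤g = +-mono-≤ (f≤g zero) (sumFin-mono (λ i → f≤g (suc i)))

sumFin-zero : ∀ k → sumFin {k} (λ _ → 0) ≡ 0
sumFin-zero ℕ.zero  = refl
sumFin-zero (suc k) = sumFin-zero k

sumFin-+ : ∀ {k} (f g : Fin k → ℕ) → sumFin (λ i → f i + g i) ≡ sumFin f + sumFin g
sumFin-+ {ℕ.zero} f g = refl
sumFin-+ {suc k}  f g =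
  trans (cong (f zero + g zero +_) (sumFin-+ (λ i → f (suc i)) (λ i → g (suc i))))
        (interchange (f zero) (g zero) _ _)

sumFin-*ˡ : ∀ {k} c (f : Fin k → ℕ) → sumFin (λ i → c * f i) ≡ c * sumFin f
sumFin-*ˡ {ℕ.zero} c f = ≡.sym (*-zeroʳ c)
sumFin-*ˡ {suc k}  c f =
  trans (cong (c * f zero +_) (sumFin-*ˡ c (λ i → f (suc i)))) (≡.sym (*-distribˡ-+ c (f zero) _))

sumFin-swap : ∀ {k l} (F : Fin k → Fin l → ℕ) →
  sumFin (λ i → sumFin (F i)) ≡ sumFin (λ j → sumFin (λ i → F i j))
sumFin-swap {ℕ.zero} {l} F = ≡.sym (sumFin-zero l)
sumFin-swap {suc k}      F =
  trans (cong (sumFin (F zero) +_) (sumFin-swap (λ i → F (suc i))))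
        (≡.sym (sumFin-+ (F zero) (λ j → sumFin (λ i → F (suc i) j))))

sumFin-when : ∀ {k} (p : Fin k → Bool) x → sumFin (λ i → when (p i) x) ≡ x * count p
sumFin-when p x = trans (sumFin-cong pointwise) (sumFin-*ˡ x (λ i → χ (p i)))
  where
  pointwise : ∀ i → when (p i) x ≡ x * χ (p i)
  pointwise i with p i
  ... | true  = ≡.sym (*-identityʳ x)
  ... | false = ≡.sym (*-zeroʳ x)

_==_ : ∀ {k} → Fin k → Fin k → Bool
u == x = ⌊ u ≟ x ⌋

==-refl : ∀ {k} (x : Fin k) → (x == x) ≡ true
==-refl x with x ≟ x
... | yes _  = refl
... | no x≢x = contradiction refl x≢x

⌊⌋⇒ : ∀ {A : Set} (a? : Dec A) → ⌊ a? ⌋ ≡ true → A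
⌊⌋⇒ a? isYes = toWitness {a? = a?} (Equivalence.from T-≡ isYes)

⇒⌊⌋ : ∀ {A : Set} (a? : Dec A) → A → ⌊ a? ⌋ ≡ true
⇒⌊⌋ a? a = trans (isYes≗does a?) (dec-true a? a)

==⇒≡ : ∀ {k} {u x : Fin k} → (u == x) ≡ true → u ≡ x
==⇒≡ {u = u} {x} = ⌊⌋⇒ (u ≟ x)

==-suc : ∀ {k} (u x : Fin k) → (suc u == suc x) ≡ (u == x)
==-suc u x with u ≟ x
... | yes _ = refl
... | no _  = refl

_except_ : ∀ {k} → (Fin k → ℕ) → Fin k → Fin k → ℕ
(f except x) u = if u == x then 0 else f u

except-cong : ∀ {k} {f g : Fin k → ℕ} x → (∀ v → (v == x) ≡ false → f v ≡ g v) →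
  ∀ v → (f except x) v ≡ (g except x) v
except-cong x f≗g v with v == x in v==x
... | true  = refl
... | false = f≗g v v==x

sumFin-pick : ∀ {k} (f : Fin k → ℕ) x → sumFin f ≡ f x + sumFin (f except x)
sumFin-pick f zero    = refl
sumFin-pick f (suc x) = begin
  f zero + sumFin (λ i → f (suc i))       ≡⟨ cong (f zero +_) (sumFin-pick (λ i → f (suc i)) x) ⟩
  f zero + (f (suc x) + rest)             ≡⟨ x∙yz≈y∙xz (f zero) (f (suc x)) rest ⟩
  f (suc x) + (f zero + rest)             ≡⟨ cong (λ r → f (suc x) + (f zero + r)) (sumFin-cong rest-suc) ⟩
  f (suc x) + sumFin (f except suc x)    ∎
  where
  open ≡-Reasoning
  rest : ℕ
  rest = sumFin ((λ i → f (suc i)) except x)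
  rest-suc : ∀ i → ((λ i → f (suc i)) except x) i ≡ (f except suc x) (suc i)
  rest-suc i = cong (λ b → if b then 0 else f (suc i)) (≡.sym (==-suc i x))

sumFin-at : ∀ {k} (g : Fin k → ℕ) x → sumFin (λ u → when (u == x) (g u)) ≡ g x
sumFin-at {k} g x = begin
  sumFin δg                                           ≡⟨ sumFin-pick δg x ⟩
  δg x + sumFin (δg except x)                         ≡⟨ cong₂ _+_ (cong (λ b → when b (g x)) (==-refl x))
                                                                  (trans (sumFin-cong off-x) (sumFin-zero k)) ⟩
  g x + 0                                             ≡⟨ +-identityʳ (g x) ⟩
  g x                                                 ∎
  where
  open ≡-Reasoning
  δg : Fin k → ℕ
  δg u = when (u == x) (g u)
  off-x : ∀ u → (δg except x) u ≡ 0
  off-x u with u == x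
  ... | true  = refl
  ... | false = refl

sumFin²-pick : ∀ {k} (F : Fin k → Fin k → ℕ) x →
  sumFin (λ v → sumFin (F v)) ≡
  sumFin (F x) + (sumFin ((λ v → F v x) except x) + sumFin ((λ v → sumFin (F v except x)) except x))
sumFin²-pick F x =
  trans (sumFin-pick (λ v → sumFin (F v)) x) (cong (sumFin (F x) +_)
    (trans (sumFin-cong split) (sumFin-+ ((λ v → F v x) except x) ((λ v → sumFin (F v except x)) except x))))
  where
  split : ∀ v → ((λ v → sumFin (F v)) except x) v
              ≡ ((λ v → F v x) except x) v + ((λ v → sumFin (F v except x)) except x) v
  split v with v == x
  ... | true  = refl
  ... | false = sumFin-pick (F v) x

_⊆_ : ∀ {k} → (Fin k → Bool) → (Fin k → Bool) → Set
p ⊆ q = ∀ i → p i ≡ true → q i ≡ true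

count-cong : ∀ {k} {p q : Fin k → Bool} → (∀ i → p i ≡ q i) → count p ≡ count q
count-cong p≗q = sumFin-cong (λ i → cong χ (p≗q i))

count-mono : ∀ {k} {p q : Fin k → Bool} → p ⊆ q → count p ≤ count q
count-mono {p = p} {q} p⊆q = sumFin-mono χ-mono
  where
  χ-mono : ∀ i → χ (p i) ≤ χ (q i)
  χ-mono i with p i in pᵢ | q i in qᵢ
  ... | false | _     = z≤n
  ... | true  | true  = ≤-refl
  ... | true  | false = contradiction (trans (≡.sym (p⊆q i pᵢ)) qᵢ) λ ()

count-split : ∀ {k} (p c : Fin k → Bool) →
  count p ≡ count (λ i → p i ∧ c i) + count (λ i → p i ∧ not (c i))
count-split p c = trans (sumFin-cong split) (sumFin-+ (λ i → χ (p i ∧ c i)) (λ i → χ (p i ∧ not (c i))))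
  where
  split : ∀ i → χ (p i) ≡ χ (p i ∧ c i) + χ (p i ∧ not (c i))
  split i with p i | c i
  ... | true  | true  = refl
  ... | true  | false = refl
  ... | false | _     = refl

_─_ : ∀ {k} → (Fin k → Bool) → Fin k → Fin k → Bool

_∖_ : ∀ {k} → (Fin k → Bool) → (Fin k → Bool) → Fin k → Bool
(Y ∖ X) v = Y v ∧ not (X v)

sumFin-when-∖ : ∀ {k} {X Y : Fin k → Bool} → X ⊆ Y → ∀ (f : Fin k → ℕ) →
  sumFin (λ v → when (Y v) (f v)) ≡ sumFin (λ v → when ((Y ∖ X) v) (f v)) + sumFin (λ v → when (X v) (f v))
sumFin-when-∖ {X = X} {Y} X⊆Y f =
  trans (sumFin-cong split) (sumFin-+ (λ v → when ((Y ∖ X) v) (f v)) (λ v → when (X v) (f v)))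
  where
  split : ∀ v → when (Y v) (f v) ≡ when ((Y ∖ X) v) (f v) + when (X v) (f v)
  split v with Y v in Yv | X v in Xv
  ... | true  | true  = refl
  ... | true  | false = ≡.sym (+-identityʳ _)
  ... | false | false = refl
  ... | false | true  = contradiction (trans (≡.sym (X⊆Y v Xv)) Yv) λ ()

(p ─ x) u = p u ∧ not (u == x)

count-remove : ∀ {k} (p : Fin k → Bool) {x} → p x ≡ true →
  count p ≡ suc (count (p ─ x))
count-remove p {x} px = trans (sumFin-pick (λ u → χ (p u)) x) (cong₂ _+_ (cong χ px) (sumFin-cong off-x))
  where
  off-x : ∀ u → ((λ v → χ (p v)) except x) u ≡ χ (p u ∧ not (u == x))
  off-x u with u == x | p u
  ... | true  | true  = refl
  ... | true  | false = refl
  ... | false | true  = refl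
  ... | false | false = refl

count-─ : ∀ {k} (p : Fin k → Bool) {x c} → p x ≡ true → count p ≡ suc c → count (p ─ x) ≡ c
count-─ p px count≡suc = suc-injective (trans (≡.sym (count-remove p px)) count≡suc)

count>0⇒∃ : ∀ {k} (p : Fin k → Bool) → 0 ℕ.< count p → Σ (Fin k) λ x → p x ≡ true
count>0⇒∃ {suc k} p pos with p zero in p₀
... | true  = zero , p₀
... | false = let x , px = count>0⇒∃ (λ i → p (suc i)) pos in suc x , px

count≡0⇒false : ∀ {k} (p : Fin k → Bool) → count p ≡ 0 → ∀ u → p u ≡ false
count≡0⇒false p none u with p u in pu
... | false = refl
... | true  = contradiction (trans (≡.sym none) (count-remove p pu)) λ ()

count≡2⇒pair : ∀ {k} (p : Fin k → Bool) → count p ≡ 2 →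
  Σ (Fin k) λ x → Σ (Fin k) λ y → x ≢ y × (∀ u → p u ≡ (u == x ∨ u == y))
count≡2⇒pair p two with count>0⇒∃ p (subst (0 ℕ.<_) (≡.sym two) z<s)
... | x , px with count>0⇒∃ (p ─ x) (subst (0 ℕ.<_) (≡.sym (count-─ p px two)) z<s)
... | y , p-x-y = x , y , x≢y , characterise
  where
  py : p y ≡ true
  py = ∧-conicalˡ (p y) _ p-x-y
  x≢y : x ≢ y
  x≢y refl = contradiction (trans (≡.sym (==-refl x)) (not-injective (∧-conicalʳ (p x) _ p-x-y))) λ ()
  none : ∀ u → ((p ─ x) ─ y) u ≡ false
  none = count≡0⇒false _ (count-─ (p ─ x) p-x-y (count-─ p px two))
  characterise : ∀ u → p u ≡ (u == x ∨ u == y)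
  characterise u with u == x in u==x | u == y in u==y | none u
  ... | true  | _     | _ = subst (λ z → p z ≡ true) (≡.sym (==⇒≡ u==x)) px
  ... | false | true  | _ = subst (λ z → p z ≡ true) (≡.sym (==⇒≡ u==y)) py
  ... | false | false | p-x-y≡false with p u
  ...   | false = refl

count-pair : ∀ {k} {x y : Fin k} → x ≢ y → (q : Fin k → Bool) →
  count (λ u → (u == x ∨ u == y) ∧ q u) ≡ χ (q x) + χ (q y)
count-pair {x = x} {y} x≢y q =
  trans (sumFin-cong split)
        (trans (sumFin-+ (λ u → when (u == x) (χ (q u))) (λ u → when (u == y) (χ (q u))))
               (cong₂ _+_ (sumFin-at (λ u → χ (q u)) x) (sumFin-at (λ u → χ (q u)) y)))
  where
  split : ∀ u → χ ((u == x ∨ u == y) ∧ q u) ≡ when (u == x) (χ (q u)) + when (u == y) (χ (q u))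
  split u with u == x in u==x | u == y in u==y
  ... | true  | true  = contradiction (trans (≡.sym (==⇒≡ u==x)) (==⇒≡ u==y)) x≢y
  ... | true  | false = ≡.sym (+-identityʳ _)
  ... | false | true  = refl
  ... | false | false = refl

maxFin-upper : ∀ {k} (f : Fin k → ℕ) i → f i ≤ maxFin f
maxFin-upper f zero    = m≤m⊔n (f zero) _
maxFin-upper f (suc i) = m≤n⇒m≤o⊔n (f zero) (maxFin-upper (λ j → f (suc j)) i)

maxFin-attained : ∀ {k} (f : Fin k → ℕ) → 0 ℕ.< maxFin f → Σ (Fin k) λ i → maxFin f ≡ f i
maxFin-attained {suc k} f pos with ≤-total (f zero) (maxFin (λ i → f (suc i)))
... | inj₂ f₀≥ = zero , m≥n⇒m⊔n≡m f₀≥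
... | inj₁ f₀≤ =
  let i , attained = maxFin-attained (λ i → f (suc i)) (subst (0 ℕ.<_) (m≤n⇒m⊔n≡n f₀≤) pos)
  in suc i , trans (m≤n⇒m⊔n≡n f₀≤) attained

anyFin-intro : ∀ {k} (q : Fin k → Bool) i → q i ≡ true → anyFin q ≡ true
anyFin-intro q zero    qi = cong (_∨ anyFin (λ j → q (suc j))) qi
anyFin-intro q (suc i) qi = trans (cong (q zero ∨_) (anyFin-intro (λ j → q (suc j)) i qi)) (∨-zeroʳ (q zero))

anyFin-none : ∀ {k} (q : Fin k → Bool) → (∀ i → q i ≡ false) → anyFin q ≡ false
anyFin-none {ℕ.zero} q none = refl
anyFin-none {suc k}  q none = cong₂ _∨_ (none zero) (anyFin-none (λ j → q (suc j)) (λ j → none (suc j)))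

anyFin-witness : ∀ {k} (q : Fin k → Bool) → anyFin q ≡ true → Σ (Fin k) λ i → q i ≡ true
anyFin-witness {suc k} q any with q zero in q₀
... | true  = zero , q₀
... | false = let i , qi = anyFin-witness (λ j → q (suc j)) any in suc i , qi

count-all : ∀ k → count {k} (λ _ → true) ≡ k
count-all ℕ.zero  = refl
count-all (suc k) = cong suc (count-all k)

record Enumeration {n} (p : Fin n → Bool) : Set where
  field
    size              : ℕ
    element           : Fin size → Fin n
    element-injective : ∀ a b → element a ≡ element b → a ≡ b
    element-sound     : ∀ a → p (element a) ≡ true
    index             : ∀ v → p v ≡ true → Fin size
    element-index     : ∀ v pv → element (index v pv) ≡ v
    sumFin-element    : ∀ (f : Fin n → ℕ) → sumFin (λ a → f (element a)) ≡ sumFin (λ v → when (p v) (f v))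

enumerate : ∀ {n} (p : Fin n → Bool) → Enumeration p
enumerate {ℕ.zero} p = record
  { size = 0 ; element = λ () ; element-injective = λ () ; element-sound = λ ()
  ; index = λ () ; element-index = λ () ; sumFin-element = λ _ → refl }
enumerate {suc n} p with enumerate (λ i → p (suc i)) | p zero in p₀
... | E | true = record
  { size = suc E.size ; element = element ; element-injective = injective ; element-sound = sound
  ; index = index ; element-index = element-index ; sumFin-element = sumFin-element }
  where
  module E = Enumeration E
  element : Fin (suc E.size) → Fin (suc n)
  element zero    = zero
  element (suc a) = suc (E.element a)
  injective : ∀ a b → element a ≡ element b → a ≡ b
  injective zero    zero    _  = refl
  injective (suc a) (suc b) eq = cong suc (E.element-injective a b (Finₚ.suc-injective eq))
  sound : ∀ a → p (element a) ≡ true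
  sound zero    = p₀
  sound (suc a) = E.element-sound a
  index : ∀ v → p v ≡ true → Fin (suc E.size)
  index zero    _  = zero
  index (suc v) pv = suc (E.index v pv)
  element-index : ∀ v pv → element (index v pv) ≡ v
  element-index zero    _  = refl
  element-index (suc v) pv = cong suc (E.element-index v pv)
  sumFin-element : ∀ (f : Fin (suc n) → ℕ) → sumFin (λ a → f (element a)) ≡ sumFin (λ v → when (p v) (f v))
  sumFin-element f = trans (cong (f zero +_) (E.sumFin-element (λ v → f (suc v))))
                           (cong (λ b → when b (f zero) + sumFin (λ v → when (p (suc v)) (f (suc v)))) (≡.sym p₀))
... | E | false = record
  { size = E.size ; element = λ a → suc (E.element a)
  ; element-injective = λ a b eq → E.element-injective a b (Finₚ.suc-injective eq)
  ; element-sound = E.element-sound ; index = index ; element-index = element-index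
  ; sumFin-element = sumFin-element }
  where
  module E = Enumeration E
  index : ∀ v → p v ≡ true → Fin E.size
  index zero    pv = contradiction (trans (≡.sym pv) p₀) λ ()
  index (suc v) pv = E.index v pv
  element-index : ∀ v pv → suc (E.element (index v pv)) ≡ v
  element-index zero    pv = contradiction (trans (≡.sym pv) p₀) λ ()
  element-index (suc v) pv = cong suc (E.element-index v pv)
  sumFin-element : ∀ (f : Fin (suc n) → ℕ) → sumFin (λ a → f (suc (E.element a))) ≡ sumFin (λ v → when (p v) (f v))
  sumFin-element f = trans (E.sumFin-element (λ v → f (suc v)))
                           (cong (λ b → when b (f zero) + sumFin (λ v → when (p (suc v)) (f (suc v)))) (≡.sym p₀))

module _ {n} {p : Fin n → Bool} (E : Enumeration p) where
  open Enumeration E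

  size≡count : size ≡ count p
  size≡count = trans (≡.sym (count-all size)) (sumFin-element (λ _ → 1))

  extend : (Fin size → Bool) → Fin n → Bool
  extend X v = anyFin (λ a → X a ∧ element a == v)

  extend-element : ∀ X a → extend X (element a) ≡ X a
  extend-element X a with X a in Xa
  ... | true  = anyFin-intro (λ b → X b ∧ element b == element a) a (cong₂ _∧_ Xa (==-refl (element a)))
  ... | false = anyFin-none (λ b → X b ∧ element b == element a) none
    where
    none : ∀ b → (X b ∧ element b == element a) ≡ false
    none b with element b == element a in eq
    ... | true  rewrite element-injective b a (==⇒≡ eq) = trans (∧-identityʳ (X a)) Xa
    ... | false = ∧-zeroʳ (X b)

  extend-⊆ : ∀ X → extend X ⊆ p
  extend-⊆ X v Xv =
    let a , Xa∧a==v = anyFin-witness (λ a → X a ∧ element a == v) Xv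
    in subst (λ w → p w ≡ true) (==⇒≡ (∧-conicalʳ (X a) _ Xa∧a==v)) (element-sound a)

  image≡p : ∀ v → anyFin (λ a → element a == v) ≡ p v
  image≡p v with p v in pv
  ... | true  = subst (λ w → extend (λ _ → true) w ≡ true) (element-index v pv) (extend-element _ (index v pv))
  ... | false with anyFin (λ a → element a == v) in av
  ...   | false = refl
  ...   | true  = contradiction (trans (≡.sym (extend-⊆ (λ _ → true) v av)) pv) λ ()

  sumFin-extend : ∀ X (f : Fin n → ℕ) →
    sumFin (λ a → when (X a) (f (element a))) ≡ sumFin (λ v → when (extend X v) (f v))
  sumFin-extend X f = begin
    sumFin (λ a → when (X a) (f (element a)))                ≡⟨ sumFin-cong (λ a → cong (λ b → when b _) (≡.sym (extend-element X a))) ⟩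
    sumFin (λ a → when (extend X (element a)) (f (element a))) ≡⟨ sumFin-element (λ v → when (extend X v) (f v)) ⟩
    sumFin (λ v → when (p v) (when (extend X v) (f v)))       ≡⟨ sumFin-cong inside-p ⟩
    sumFin (λ v → when (extend X v) (f v))                    ∎
    where
    open ≡-Reasoning
    inside-p : ∀ v → when (p v) (when (extend X v) (f v)) ≡ when (extend X v) (f v)
    inside-p v with extend X v in Xv
    ... | false = when-0 (p v)
    ... | true rewrite extend-⊆ X v Xv = refl

all-or-counterexample : ∀ {k} (P : (Fin k → Bool) → Set) → (∀ X → Dec (P X)) →
  (∀ {X Z} → (∀ i → X i ≡ Z i) → P X → P Z) →
  (∀ X → P X) ⊎ (Σ (Fin k → Bool) λ X → ¬ P X)
all-or-counterexample P P? P-resp with anySubset? (λ s → ¬? (P? (lookup s)))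
... | yes (s , ¬Ps) = inj₂ (lookup s , ¬Ps)
... | no ∄         = inj₁ λ X →
  P-resp (lookup∘tabulate X) (decidable-stable (P? _) (λ ¬P → ∄ (tabulate X , ¬P)))

fourthRoot : ∀ D → Σ ℕ λ R → R ^ 4 ≤ D × D ℕ.< suc R ^ 4
fourthRoot ℕ.zero = 0 , z≤n , z<s
fourthRoot (suc D) with fourthRoot D
... | R , R⁴≤D , D<[1+R]⁴ with suc D <? suc R ^ 4
...   | yes below = R , m≤n⇒m≤1+n R⁴≤D , below
...   | no  ¬below = suc R , ≮⇒≥ ¬below , ≤-<-trans (≤-reflexive (≤-antisym D<[1+R]⁴ (≮⇒≥ ¬below)))
                                                    (^-monoˡ-< 4 (n<1+n (suc R)))

≤-fourthRoot : ∀ {x R D} → x ^ 4 ≤ D → D ℕ.< suc R ^ 4 → x ≤ R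
≤-fourthRoot {x} {R} x⁴≤D D<[1+R]⁴ with x ≤? R
... | yes x≤R = x≤R
... | no  x≰R = contradiction (≤-trans (^-monoˡ-≤ 4 (≰⇒> x≰R)) x⁴≤D) (<⇒≱ D<[1+R]⁴)

^-distribʳ-* : ∀ m n o → (m * n) ^ o ≡ m ^ o * n ^ o
^-distribʳ-* m n ℕ.zero  = refl
^-distribʳ-* m n (suc o) = trans (cong (m * n *_) (^-distribʳ-* m n o)) ([m*n]*[o*p]≡[m*o]*[n*p] m n (m ^ o) (n ^ o))

[R*R]*[R*R]≡R^4 : ∀ R → (R * R) * (R * R) ≡ R * (R * (R * (R * 1)))
[R*R]*[R*R]≡R^4 = solve-∀

-- 16 R⁴ ≤ 16 D < D², so 4 R² < D.
4R²<D : ∀ R D → R ^ 4 ≤ D → 17 ≤ D → 4 * (R * R) ℕ.< D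
4R²<D R D R⁴≤D 17≤D with 4 * (R * R) <? D
... | yes lt = lt
... | no  ge = contradiction D≤16 (<⇒≱ 17≤D)
  where
  open ≤-Reasoning
  D≤16 : D ≤ 16
  D≤16 = *-cancelʳ-≤ D 16 D {{>-nonZero (≤-trans z<s 17≤D)}} (begin
    D * D                             ≤⟨ *-mono-≤ (≮⇒≥ ge) (≮⇒≥ ge) ⟩
    (4 * (R * R)) * (4 * (R * R))     ≡⟨ [m*n]*[o*p]≡[m*o]*[n*p] 4 (R * R) 4 (R * R) ⟩
    16 * ((R * R) * (R * R))          ≡⟨ cong (16 *_) ([R*R]*[R*R]≡R^4 R) ⟩
    16 * R ^ 4                        ≤⟨ *-monoʳ-≤ 16 R⁴≤D ⟩
    16 * D                            ∎)

2[R+D+R²]<3D : ∀ R D → R ^ 4 ≤ D → 17 ≤ D → 2 * (R + D + R * R) ℕ.< 3 * D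
2[R+D+R²]<3D R D R⁴≤D 17≤D = begin-strict
  2 * (R + D + R * R)              ≡⟨ rearrange R D ⟩
  2 * D + (2 * R + 2 * (R * R))    ≤⟨ +-monoʳ-≤ (2 * D) (+-monoˡ-≤ (2 * (R * R)) (*-monoʳ-≤ 2 (m≤m*m R))) ⟩
  2 * D + (2 * (R * R) + 2 * (R * R)) ≡⟨ cong (2 * D +_) (double R) ⟩
  2 * D + 4 * (R * R)              <⟨ +-monoʳ-< (2 * D) (4R²<D R D R⁴≤D 17≤D) ⟩
  2 * D + D                        ≡⟨ +-comm (2 * D) D ⟩
  3 * D                            ∎
  where
  open ≤-Reasoning
  rearrange : ∀ R D → 2 * (R + D + R * R) ≡ 2 * D + (2 * R + 2 * (R * R))
  rearrange = solve-∀
  double : ∀ R → 2 * (R * R) + 2 * (R * R) ≡ 4 * (R * R)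
  double = solve-∀
  m≤m*m : ∀ m → m ≤ m * m
  m≤m*m ℕ.zero    = z≤n
  m≤m*m (suc m) = m≤m*n (suc m) (suc m)

Δ≤Δ^9 : ∀ Δ → Δ ≤ Δ ^ 9
Δ≤Δ^9 ℕ.zero    = z≤n
Δ≤Δ^9 Δ@(suc _) = subst (_≤ Δ ^ 9) (*-identityʳ Δ) (^-monoʳ-≤ Δ {1} {9} (s≤s z≤n))

-- (S ∸ b)¹⁰ ≤ x¹⁰ Δ⁹ is the statement S - b ≤ x Δ^{9/10}, which holds once S ≤ θ x + b and θ ≤ Δ^{1/10}.
¬≤Δ^[9/10]⇒ : ∀ θ {Δ} S b x → θ ^ 10 ≤ Δ → ¬ ((S ∸ b) ^ 10 ≤ x ^ 10 * Δ ^ 9) → θ * x + b ℕ.< S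
¬≤Δ^[9/10]⇒ θ {Δ} S b x θ¹⁰≤Δ violated with S ≤? θ * x + b
... | no  S≰ = ≰⇒> S≰
... | yes S≤ = contradiction (begin
  (S ∸ b) ^ 10        ≤⟨ ^-monoˡ-≤ 10 (m≤n+o⇒m∸n≤o S b (≤-trans S≤ (≤-reflexive (+-comm (θ * x) b)))) ⟩
  (θ * x) ^ 10        ≡⟨ ^-distribʳ-* θ x 10 ⟩
  θ ^ 10 * x ^ 10     ≤⟨ *-monoˡ-≤ (x ^ 10) (≤-trans θ¹⁰≤Δ (Δ≤Δ^9 Δ)) ⟩
  Δ ^ 9 * x ^ 10      ≡⟨ *-comm (Δ ^ 9) (x ^ 10) ⟩
  x ^ 10 * Δ ^ 9      ∎) violated
  where open ≤-Reasoning

-- A core vertex of Y outside the core of Y ∖ X keeps at most one neighbour in Y ∖ X, and keeps one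
-- only when X contains exactly one of its two neighbours in Y.
pairSplit≤ : ∀ (l : Bool) y y' x → y ≡ y' + x →
  when ((l ∧ ⌊ y ℕ.≟ 2 ⌋) ∧ not (l ∧ ⌊ y' ℕ.≟ 2 ⌋)) y' ≤ χ ((l ∧ ⌊ y ℕ.≟ 2 ⌋) ∧ ⌊ x ℕ.≟ 1 ⌋)
pairSplit≤ false y y' x _ = z≤n
pairSplit≤ true  y y' x y≡y'+x with y ℕ.≟ 2
... | no _ = z≤n
pairSplit≤ true .2 0 x _       | yes refl = z≤n
pairSplit≤ true .2 1 1 _       | yes refl = ≤-refl
pairSplit≤ true .2 2 x _       | yes refl = z≤n
pairSplit≤ true .2 (suc (suc (suc y'))) x () | yes refl

module LocalMaxCut {k} (E : Fin k → Fin k → Bool)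
                   (E-sym : ∀ v w → E v w ≡ E w v) (E-irrefl : ∀ v → E v v ≡ false) where

  degreeSum : ℕ
  degreeSum = sumFin (λ v → count (E v))

  across same : (Fin k → Bool) → Fin k → ℕ
  across B v = count (λ w → E v w ∧ (B w xor B v))
  same   B v = count (λ w → E v w ∧ not (B w xor B v))

  cut : (Fin k → Bool) → ℕ
  cut B = sumFin (across B)

  flip : (Fin k → Bool) → Fin k → Fin k → Bool
  flip B x u = if u == x then not (B u) else B u

  private
    crosses : (Fin k → Bool) → Fin k → Fin k → ℕ
    crosses B v w = χ (E v w ∧ (B w xor B v))

    crosses-sym : ∀ B v w → crosses B v w ≡ crosses B w v
    crosses-sym B v w = cong₂ (λ e b → χ (e ∧ b)) (E-sym v w) (xor-comm (B w) (B v))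

    crosses-diag : ∀ B {v w} → v ≡ w → crosses B v w ≡ 0
    crosses-diag B {v} refl = cong (λ e → χ (e ∧ _)) (E-irrefl v)

    rest : (Fin k → Bool) → Fin k → ℕ
    rest B x = sumFin ((λ v → sumFin (crosses B v except x)) except x)

    cut-through : ∀ B x → cut B ≡ across B x + (across B x + rest B x)
    cut-through B x = trans (sumFin²-pick (crosses B) x) (cong (λ c → across B x + (c + rest B x)) column)
      where
      column : sumFin ((λ v → crosses B v x) except x) ≡ across B x
      column = sumFin-cong pointwise
        where
        pointwise : ∀ v → ((λ v → crosses B v x) except x) v ≡ crosses B x v
        pointwise v with v == x in v==x
        ... | true  = ≡.sym (crosses-diag B (≡.sym (==⇒≡ v==x)))
        ... | false = crosses-sym B v x

    across-flip : ∀ B x → across (flip B x) x ≡ same B x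
    across-flip B x = sumFin-cong pointwise
      where
      pointwise : ∀ w → crosses (flip B x) x w ≡ χ (E x w ∧ not (B w xor B x))
      pointwise w rewrite ==-refl x with w == x in w==x
      ... | true  rewrite ==⇒≡ w==x | E-irrefl x = refl
      ... | false = cong (λ b → χ (E x w ∧ b)) (≡.sym (not-distribʳ-xor (B w) (B x)))

    rest-flip : ∀ B x → rest (flip B x) x ≡ rest B x
    rest-flip B x = sumFin-cong (except-cong x λ v v≢x → sumFin-cong (except-cong x λ w w≢x → unflipped v≢x w≢x))
      where
      unflipped : ∀ {v w} → (v == x) ≡ false → (w == x) ≡ false → crosses (flip B x) v w ≡ crosses B v w
      unflipped v≢x w≢x rewrite v≢x | w≢x = refl

  cut-flip : ∀ B x → across B x ℕ.< same B x → cut B ℕ.< cut (flip B x)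
  cut-flip B x a<s = begin-strict
    cut B                                        ≡⟨ cut-through B x ⟩
    across B x + (across B x + rest B x)         <⟨ +-mono-<-≤ a<s (+-monoˡ-≤ (rest B x) (<⇒≤ a<s)) ⟩
    same B x + (same B x + rest B x)             ≡⟨ cong₂ (λ c r → c + (c + r)) (≡.sym (across-flip B x)) (≡.sym (rest-flip B x)) ⟩
    across (flip B x) x + (across (flip B x) x + rest (flip B x) x) ≡⟨ ≡.sym (cut-through (flip B x) x) ⟩
    cut (flip B x)                               ∎
    where open ≤-Reasoning

  cut≤degreeSum : ∀ B → cut B ≤ degreeSum
  cut≤degreeSum B = sumFin-mono λ v → count-mono λ w → ∧-conicalˡ (E v w) _

  LocallyMaximal : (Fin k → Bool) → Set
  LocallyMaximal B = ∀ v → same B v ≤ across B v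

  -- Each flip raises the cut, which is bounded by degreeSum.
  locallyMaximal : Σ (Fin k → Bool) LocallyMaximal
  locallyMaximal = climb (suc degreeSum) (λ _ → false) (s≤s (m∸n≤m degreeSum (cut (λ _ → false))))
    where
    climb : ∀ fuel B → degreeSum ∸ cut B ℕ.< fuel → Σ (Fin k → Bool) LocallyMaximal
    climb (suc fuel) B bound with Finₚ.any? (λ v → across B v <? same B v)
    ... | no  ∄ = B , λ v → ≮⇒≥ λ a<s → ∄ (v , a<s)
    ... | yes (x , a<s) =
      climb fuel (flip B x) (≤-trans (∸-monoʳ-< (cut-flip B x a<s) (cut≤degreeSum (flip B x))) (≤-pred bound))

  degreeSum≤2*cut : ∀ B → LocallyMaximal B → degreeSum ≤ 2 * cut B
  degreeSum≤2*cut B maximal = begin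
    degreeSum                                     ≡⟨ sumFin-cong (λ v → count-split (E v) (λ w → not (B w xor B v))) ⟩
    sumFin (λ v → same B v + count (λ w → E v w ∧ not (not (B w xor B v))))
      ≡⟨ sumFin-cong (λ v → cong (same B v +_) (count-cong λ w → cong (E v w ∧_) (not-involutive _))) ⟩
    sumFin (λ v → same B v + across B v)          ≤⟨ sumFin-mono (λ v → +-monoˡ-≤ (across B v) (maximal v)) ⟩
    sumFin (λ v → across B v + across B v)        ≡⟨ sumFin-+ (across B) (across B) ⟩
    cut B + cut B                                 ≡⟨ cong (cut B +_) (≡.sym (+-identityʳ (cut B))) ⟩
    2 * cut B                                     ∎
    where open ≤-Reasoning

module _ (G : Graph) where

  deg≤maxDeg : ∀ v → deg G v ≤ maxDeg G
  deg≤maxDeg = maxFin-upper (deg G)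

  bigB⇒ : ∀ {u} → bigB G u ≡ true → maxDeg G ≤ deg G u ^ 4
  bigB⇒ {u} isBig with maxDeg G ≤? deg G u ^ 4
  ... | yes Δ≤d⁴ = Δ≤d⁴

  ¬bigB⇒ : ∀ {u} → bigB G u ≡ false → deg G u ^ 4 ℕ.< maxDeg G
  ¬bigB⇒ {u} notBig with maxDeg G ≤? deg G u ^ 4
  ... | no Δ≰d⁴ = ≰⇒> Δ≰d⁴

  deg²≤deg+∑deg : ∀ v → deg² G v ≤ deg G v + sumFin (λ u → when (adj G v u) (deg G u))
  deg²≤deg+∑deg v = begin
    deg² G v
      ≤⟨ sumFin-mono atDistance≤2 ⟩
    sumFin (λ w → χ (adj G v w) + count (λ u → adj G v u ∧ adj G u w))
      ≡⟨ sumFin-+ (λ w → χ (adj G v w)) (λ w → count (λ u → adj G v u ∧ adj G u w)) ⟩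
    deg G v + sumFin (λ w → sumFin (λ u → χ (adj G v u ∧ adj G u w)))
      ≡⟨ cong (deg G v +_) (sumFin-swap (λ w u → χ (adj G v u ∧ adj G u w))) ⟩
    deg G v + sumFin (λ u → sumFin (λ w → χ (adj G v u ∧ adj G u w)))
      ≡⟨ cong (deg G v +_) (sumFin-cong viaNeighbour) ⟩
    deg G v + sumFin (λ u → when (adj G v u) (deg G u)) ∎
    where
    open ≤-Reasoning
    χ-∨ : ∀ a b c → χ (a ∧ (b ∨ c)) ≤ χ b + χ c
    χ-∨ false b     c = z≤n
    χ-∨ true  true  c = s≤s z≤n
    χ-∨ true  false c = ≤-refl
    χ-anyFin : ∀ {k} (q : Fin k → Bool) → χ (anyFin q) ≤ count q
    χ-anyFin {ℕ.zero} q = z≤n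
    χ-anyFin {suc k}  q with q zero
    ... | true  = s≤s z≤n
    ... | false = χ-anyFin (λ i → q (suc i))
    atDistance≤2 : ∀ w → χ (adj² G v w) ≤ χ (adj G v w) + count (λ u → adj G v u ∧ adj G u w)
    atDistance≤2 w = ≤-trans (χ-∨ (not (v == w)) (adj G v w) _)
                             (+-monoʳ-≤ (χ (adj G v w)) (χ-anyFin (λ u → adj G v u ∧ adj G u w)))
    viaNeighbour : ∀ u → sumFin (λ w → χ (adj G v u ∧ adj G u w)) ≡ when (adj G v u) (deg G u)
    viaNeighbour u with adj G v u
    ... | true  = refl
    ... | false = sumFin-zero (n G)

  sumFin-nbrsIn-swap : ∀ (A B : V G → Bool) →
    sumFin (λ v → when (A v) (nbrsIn G B v)) ≡ sumFin (λ w → when (B w) (nbrsIn G A w))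
  sumFin-nbrsIn-swap A B = begin
    sumFin (λ v → when (A v) (nbrsIn G B v))          ≡⟨ sumFin-cong (λ v → expand B v (A v)) ⟩
    sumFin (λ v → sumFin (λ w → χ (edge v w)))        ≡⟨ sumFin-swap (λ v w → χ (edge v w)) ⟩
    sumFin (λ w → sumFin (λ v → χ (edge v w)))        ≡⟨ sumFin-cong (λ w → sumFin-cong (λ v → cong χ (edge-sym v w))) ⟩
    sumFin (λ w → sumFin (λ v → χ (B w ∧ adj G w v ∧ A v))) ≡⟨ ≡.sym (sumFin-cong (λ w → expand A w (B w))) ⟩
    sumFin (λ w → when (B w) (nbrsIn G A w))          ∎
    where
    open ≡-Reasoning
    edge : V G → V G → Bool
    edge v w = A v ∧ adj G v w ∧ B w
    expand : ∀ C v a → when a (nbrsIn G C v) ≡ sumFin (λ w → χ (a ∧ adj G v w ∧ C w))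
    expand C v true  = refl
    expand C v false = ≡.sym (sumFin-zero (n G))
    edge-sym : ∀ v w → edge v w ≡ (B w ∧ adj G w v ∧ A v)
    edge-sym v w rewrite Graph.sym G v w with A v | B w | adj G w v
    ... | true  | true  | _     = refl
    ... | true  | false | true  = refl
    ... | true  | false | false = refl
    ... | false | true  | true  = refl
    ... | false | true  | false = refl
    ... | false | false | _     = refl

  nbrsIn-∖ : ∀ {X Y} → X ⊆ Y → ∀ w → nbrsIn G Y w ≡ nbrsIn G (Y ∖ X) w + nbrsIn G X w
  nbrsIn-∖ {X} {Y} X⊆Y w = begin
    nbrsIn G Y w                                                       ≡⟨ asWhen Y ⟩
    sumFin (λ u → when (Y u) (χ (adj G w u)))                          ≡⟨ sumFin-when-∖ X⊆Y (λ u → χ (adj G w u)) ⟩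
    sumFin (λ u → when ((Y ∖ X) u) (χ (adj G w u))) + sumFin (λ u → when (X u) (χ (adj G w u)))
                                                                       ≡⟨ ≡.sym (cong₂ _+_ (asWhen (Y ∖ X)) (asWhen X)) ⟩
    nbrsIn G (Y ∖ X) w + nbrsIn G X w                                  ∎
    where
    open ≡-Reasoning
    asWhen : ∀ Z → nbrsIn G Z w ≡ sumFin (λ u → when (Z u) (χ (adj G w u)))
    asWhen Z = sumFin-cong (λ u → χ-∧ʳ (adj G w u) (Z u))

  -- w has at most one big neighbour, and w and its other neighbours have degree at most
  -- R = ⌊Δ^{1/4}⌋, so deg² w ≤ R + Δ + R².
  outcomeA : 17 ≤ maxDeg G → ∀ w → bigB G w ≡ false → nbrsIn G (bigB G) w ≤ 1 → OutcomeA G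
  outcomeA 17≤Δ w small ≤1big =
    w , (<⇒≤ (¬bigB⇒ small) , ≤-trans ≤1big (n≤1+n 1))
      , inj₁ (≤-<-trans (*-monoʳ-≤ 2 deg²≤) (2[R+D+R²]<3D R Δ R⁴≤Δ 17≤Δ))
    where
    open ≤-Reasoning
    Δ R : ℕ
    Δ = maxDeg G
    R = proj₁ (fourthRoot Δ)
    R⁴≤Δ : R ^ 4 ≤ Δ
    R⁴≤Δ = proj₁ (proj₂ (fourthRoot Δ))
    small≤R : ∀ {u} → bigB G u ≡ false → deg G u ≤ R
    small≤R small = ≤-fourthRoot (<⇒≤ (¬bigB⇒ small)) (proj₂ (proj₂ (fourthRoot Δ)))
    neighbourDeg : ∀ u → when (adj G w u) (deg G u) ≤ when (adj G w u ∧ bigB G u) Δ + when (adj G w u) R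
    neighbourDeg u with adj G w u
    ... | false = z≤n
    ... | true with bigB G u in isBig
    ...   | true  = ≤-trans (deg≤maxDeg u) (m≤m+n Δ R)
    ...   | false = small≤R isBig
    deg²≤ : deg² G w ≤ R + Δ + R * R
    deg²≤ = begin
      deg² G w                                                    ≤⟨ deg²≤deg+∑deg w ⟩
      deg G w + sumFin (λ u → when (adj G w u) (deg G u))          ≤⟨ +-monoʳ-≤ (deg G w) (sumFin-mono neighbourDeg) ⟩
      deg G w + sumFin (λ u → when (adj G w u ∧ bigB G u) Δ + when (adj G w u) R)
        ≡⟨ cong (deg G w +_) (trans (sumFin-+ (λ u → when (adj G w u ∧ bigB G u) Δ) (λ u → when (adj G w u) R))
                                  (cong₂ _+_ (sumFin-when (λ u → adj G w u ∧ bigB G u) Δ) (sumFin-when (adj G w) R))) ⟩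
      deg G w + (Δ * nbrsIn G (bigB G) w + R * deg G w)
        ≤⟨ +-mono-≤ (small≤R small) (+-mono-≤ (≤-trans (*-monoʳ-≤ Δ ≤1big) (≤-reflexive (*-identityʳ Δ)))
                                               (*-monoʳ-≤ R (small≤R small))) ⟩
      R + (Δ + R * R)                                              ≡⟨ ≡.sym (+-assoc R Δ (R * R)) ⟩
      R + Δ + R * R                                                ∎

module Sparse (G : Graph) (β : ℕ) (bound : ∀ B → eAB G B ≤ β * count B) where

  -- A vertex outside C with at most two neighbours in C is paid for by the 2 in β + 2.
  outsideNbrs≤ : ∀ (S C : V G → Bool) → C ⊆ S →
    sumFin (λ v → when (S v ∧ not (C v)) (nbrsIn G C v)) ≤ (β + 2) * count S
  outsideNbrs≤ S C C⊆S = begin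
    sumFin (λ v → when (S v ∧ not (C v)) (nbrsIn G C v))      ≤⟨ sumFin-mono pointwise ⟩
    sumFin (λ v → heavy v + 2 * χ (S v))                     ≡⟨ sumFin-+ heavy (λ v → 2 * χ (S v)) ⟩
    eAB G C + sumFin (λ v → 2 * χ (S v))                     ≡⟨ cong (eAB G C +_) (sumFin-*ˡ 2 (λ v → χ (S v))) ⟩
    eAB G C + 2 * count S                                    ≤⟨ +-monoˡ-≤ (2 * count S) (≤-trans (bound C) (*-monoʳ-≤ β (count-mono C⊆S))) ⟩
    β * count S + 2 * count S                                ≡⟨ ≡.sym (*-distribʳ-+ (count S) β 2) ⟩
    (β + 2) * count S                                        ∎
    where
    open ≤-Reasoning
    heavy : V G → ℕ
    heavy v = if not (C v) ∧ ⌊ 3 ≤? nbrsIn G C v ⌋ then nbrsIn G C v else 0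
    pointwise : ∀ v → when (S v ∧ not (C v)) (nbrsIn G C v) ≤ heavy v + 2 * χ (S v)
    pointwise v with S v | C v
    ... | false | _     = z≤n
    ... | true  | true  = z≤n
    ... | true  | false with 3 ≤? nbrsIn G C v
    ...   | yes _  = m≤m+n (nbrsIn G C v) 2
    ...   | no  ≱3 = ≤-pred (≰⇒> ≱3)

  inducedDegreeSum≤ : ∀ S → sumFin (λ v → when (S v) (nbrsIn G S v)) ≤ 4 * (β + 2) * count S
  inducedDegreeSum≤ S = begin
    sumFin (λ v → when (S v) (nbrsIn G S v))   ≡⟨ sumFin-cong induced ⟩
    degreeSum                                   ≤⟨ degreeSum≤2*cut B maximal ⟩
    2 * cut B                                   ≤⟨ *-monoʳ-≤ 2 cut≤ ⟩
    2 * ((β + 2) * count S + (β + 2) * count S) ≡⟨ double (β + 2) (count S) ⟩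
    4 * (β + 2) * count S                       ∎
    where
    open ≤-Reasoning
    E : V G → V G → Bool
    E v w = S v ∧ adj G v w ∧ S w
    E-sym : ∀ v w → E v w ≡ E w v
    E-sym v w rewrite Graph.sym G v w with S v | S w
    ... | true  | true  = refl
    ... | true  | false = ∧-zeroʳ (adj G w v)
    ... | false | true  = ≡.sym (∧-zeroʳ (adj G w v))
    ... | false | false = refl
    E-irrefl : ∀ v → E v v ≡ false
    E-irrefl v with S v
    ... | true  rewrite irrefl G v = refl
    ... | false = refl
    open LocalMaxCut E E-sym E-irrefl
    B : V G → Bool
    B = proj₁ locallyMaximal
    maximal : LocallyMaximal B
    maximal = proj₂ locallyMaximal
    double : ∀ a c → 2 * (a * c + a * c) ≡ 4 * a * c
    double = solve-∀
    induced : ∀ v → when (S v) (nbrsIn G S v) ≡ count (E v)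
    induced v with S v
    ... | true  = refl
    ... | false = ≡.sym (sumFin-zero (n G))
    side₁ side₂ : V G → Bool
    side₁ w = S w ∧ B w
    side₂ w = S w ∧ not (B w)
    cutBySides : ∀ v → across B v ≤ when (S v ∧ not (side₁ v)) (nbrsIn G side₁ v)
                                   + when (S v ∧ not (side₂ v)) (nbrsIn G side₂ v)
    cutBySides v with S v | B v
    ... | false | _     = ≤-reflexive (sumFin-zero (n G))
    ... | true  | true  = ≤-reflexive (count-cong λ w →
      trans (∧-assoc (adj G v w) (S w) _) (cong (λ b → adj G v w ∧ (S w ∧ b)) (trans (xor-comm (B w) true) (true-xor (B w)))))
    ... | true  | false = ≤-reflexive (trans (count-cong λ w →
      trans (∧-assoc (adj G v w) (S w) _) (cong (λ b → adj G v w ∧ (S w ∧ b)) (xor-identityʳ (B w)))) (≡.sym (+-identityʳ _)))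
    cut≤ : cut B ≤ (β + 2) * count S + (β + 2) * count S
    cut≤ = ≤-trans (sumFin-mono cutBySides)
      (≤-trans (≤-reflexive (sumFin-+ (λ v → when (S v ∧ not (side₁ v)) (nbrsIn G side₁ v))
                                      (λ v → when (S v ∧ not (side₂ v)) (nbrsIn G side₂ v))))
               (+-mono-≤ (outsideNbrs≤ S side₁ (λ v → ∧-conicalˡ (S v) _))
                         (outsideNbrs≤ S side₂ (λ v → ∧-conicalˡ (S v) _))))

module Core (G : Graph) where

  big : V G → Bool
  big = bigB G

  hasTwoBigNbrs : V G → Bool
  hasTwoBigNbrs w = not (big w) ∧ ⌊ nbrsIn G big w ℕ.≟ 2 ⌋

  -- H_Y has vertex set Y and one edge per vertex of core Y, joining its two big neighbours.
  core : (V G → Bool) → V G → Bool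
  core Y w = hasTwoBigNbrs w ∧ ⌊ nbrsIn G Y w ℕ.≟ 2 ⌋

  degOffCore : (V G → Bool) → V G → ℕ
  degOffCore Y v = count (λ w → adj G v w ∧ not (core Y w))

  crossingCore : (V G → Bool) → (V G → Bool) → ℕ
  crossingCore Y X = count (λ w → core Y w ∧ ⌊ nbrsIn G X w ℕ.≟ 1 ⌋)

  Φ : ℕ → (V G → Bool) → ℕ
  Φ θ Y = sumFin (λ v → when (Y v) (degOffCore Y v)) + θ * count (big ∖ Y)

  Φ-∖ : ∀ θ {X Y} → X ⊆ Y → Y ⊆ big →
    θ * count X + crossingCore Y X ℕ.< sumFin (λ v → when (X v) (degOffCore Y v)) → Φ θ (Y ∖ X) ℕ.< Φ θ Y
  Φ-∖ θ {X} {Y} X⊆Y Y⊆big violated = begin-strict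
    Φ θ Y′                                   ≤⟨ +-monoˡ-≤ _ degSum-Y′ ⟩
    (kept + ∂) + θ * count (big ∖ Y′)        ≡⟨ cong (λ c → (kept + ∂) + θ * c) count-big∖Y′ ⟩
    (kept + ∂) + θ * (count (big ∖ Y) + count X) ≡⟨ rearrange kept ∂ θ (count (big ∖ Y)) (count X) ⟩
    kept + (θ * count X + ∂) + θ * count (big ∖ Y) <⟨ +-monoˡ-< _ (+-monoʳ-< kept violated) ⟩
    kept + removed + θ * count (big ∖ Y)     ≡⟨ cong (_+ θ * count (big ∖ Y)) (≡.sym (sumFin-when-∖ X⊆Y (degOffCore Y))) ⟩
    Φ θ Y                                    ∎
    where
    open ≤-Reasoning
    Y′ : V G → Bool
    Y′ = Y ∖ X
    ∂ kept removed : ℕ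
    ∂ = crossingCore Y X
    kept = sumFin (λ v → when (Y′ v) (degOffCore Y v))
    removed = sumFin (λ v → when (X v) (degOffCore Y v))
    rearrange : ∀ a d t c x → (a + d) + t * (c + x) ≡ a + (t * x + d) + t * c
    rearrange = solve-∀
    leaves : V G → Bool
    leaves w = core Y w ∧ not (core Y′ w)
    degOffCore-Y′ : ∀ v → degOffCore Y′ v ≤ degOffCore Y v + nbrsIn G leaves v
    degOffCore-Y′ v = ≤-trans (sumFin-mono pointwise)
      (≤-reflexive (sumFin-+ (λ w → χ (adj G v w ∧ not (core Y w))) (λ w → χ (adj G v w ∧ leaves w))))
      where
      pointwise : ∀ w → χ (adj G v w ∧ not (core Y′ w)) ≤ χ (adj G v w ∧ not (core Y w)) + χ (adj G v w ∧ leaves w)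
      pointwise w with adj G v w | core Y w | core Y′ w
      ... | false | _     | _     = z≤n
      ... | true  | _     | true  = z≤n
      ... | true  | false | false = s≤s z≤n
      ... | true  | true  | false = s≤s z≤n
    degSum-Y′ : sumFin (λ v → when (Y′ v) (degOffCore Y′ v)) ≤ kept + ∂
    degSum-Y′ = begin
      sumFin (λ v → when (Y′ v) (degOffCore Y′ v))
        ≤⟨ sumFin-mono pointwise ⟩
      sumFin (λ v → when (Y′ v) (degOffCore Y v) + when (Y′ v) (nbrsIn G leaves v))
        ≡⟨ sumFin-+ (λ v → when (Y′ v) (degOffCore Y v)) (λ v → when (Y′ v) (nbrsIn G leaves v)) ⟩
      kept + sumFin (λ v → when (Y′ v) (nbrsIn G leaves v))
        ≡⟨ cong (kept +_) (sumFin-nbrsIn-swap G Y′ leaves) ⟩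
      kept + sumFin (λ w → when (leaves w) (nbrsIn G Y′ w))
        ≤⟨ +-monoʳ-≤ kept (sumFin-mono λ w →
             pairSplit≤ (hasTwoBigNbrs w) (nbrsIn G Y w) (nbrsIn G Y′ w) (nbrsIn G X w) (nbrsIn-∖ G X⊆Y w)) ⟩
      kept + ∂ ∎
      where
      pointwise : ∀ v → when (Y′ v) (degOffCore Y′ v) ≤ when (Y′ v) (degOffCore Y v) + when (Y′ v) (nbrsIn G leaves v)
      pointwise v with Y′ v
      ... | true  = degOffCore-Y′ v
      ... | false = z≤n
    count-big∖Y′ : count (big ∖ Y′) ≡ count (big ∖ Y) + count X
    count-big∖Y′ = trans (sumFin-cong pointwise) (sumFin-+ (λ v → χ ((big ∖ Y) v)) (λ v → χ (X v)))
      where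
      pointwise : ∀ v → χ ((big ∖ Y′) v) ≡ χ ((big ∖ Y) v) + χ (X v)
      pointwise v with X v in Xv | Y v in Yv | big v in bigv
      ... | false | true  | true  = refl
      ... | false | true  | false = refl
      ... | false | false | true  = refl
      ... | false | false | false = refl
      ... | true  | true  | true  = refl
      ... | true  | true  | false = contradiction (trans (≡.sym (Y⊆big v Yv)) bigv) λ ()
      ... | true  | false | _     = contradiction (trans (≡.sym (X⊆Y v Xv)) Yv) λ ()

module Copy (G : Graph) (Y : V G → Bool) (Y⊆big : Y ⊆ Core.big G) where
  open Core G

  branch : Enumeration Y
  branch = enumerate Y

  subdivision : Enumeration (core Y)
  subdivision = enumerate (core Y)

  module Branch = Enumeration branch
  module Subdiv = Enumeration subdivision

  private
    coreVertex : Fin Subdiv.size → V G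
    coreVertex = Subdiv.element

    coreVertex∈core : ∀ e → core Y (coreVertex e) ≡ true
    coreVertex∈core = Subdiv.element-sound

    twoBigNbrs : ∀ e → hasTwoBigNbrs (coreVertex e) ≡ true
    twoBigNbrs e = ∧-conicalˡ _ _ (coreVertex∈core e)

    small : ∀ e → big (coreVertex e) ≡ false
    small e = not-injective (∧-conicalˡ _ _ (twoBigNbrs e))

    Y-nbrs : ∀ e → Σ (V G) λ x → Σ (V G) λ y → x ≢ y × (∀ u → (adj G (coreVertex e) u ∧ Y u) ≡ (u == x ∨ u == y))
    Y-nbrs e = count≡2⇒pair (λ u → adj G (coreVertex e) u ∧ Y u) (⌊⌋⇒ (_ ℕ.≟ 2) (∧-conicalʳ _ _ (coreVertex∈core e)))

  end₁ end₂ : Fin Subdiv.size → V G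
  end₁ e = proj₁ (Y-nbrs e)
  end₂ e = proj₁ (proj₂ (Y-nbrs e))

  end₁≢end₂ : ∀ e → end₁ e ≢ end₂ e
  end₁≢end₂ e = proj₁ (proj₂ (proj₂ (Y-nbrs e)))

  Y-nbrs≡ends : ∀ e u → (adj G (coreVertex e) u ∧ Y u) ≡ (u == end₁ e ∨ u == end₂ e)
  Y-nbrs≡ends e = proj₂ (proj₂ (proj₂ (Y-nbrs e)))

  private
    Y-nbr : ∀ e {u} → (u == end₁ e ∨ u == end₂ e) ≡ true → (adj G (coreVertex e) u ∧ Y u) ≡ true
    Y-nbr e {u} isEnd = trans (Y-nbrs≡ends e u) isEnd

    end₁-nbr : ∀ e → (adj G (coreVertex e) (end₁ e) ∧ Y (end₁ e)) ≡ true
    end₁-nbr e = Y-nbr e (cong (_∨ end₁ e == end₂ e) (==-refl (end₁ e)))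

    end₂-nbr : ∀ e → (adj G (coreVertex e) (end₂ e) ∧ Y (end₂ e)) ≡ true
    end₂-nbr e = Y-nbr e (trans (cong (end₂ e == end₁ e ∨_) (==-refl (end₂ e))) (∨-zeroʳ _))

    end₁∈Y : ∀ e → Y (end₁ e) ≡ true
    end₁∈Y e = ∧-conicalʳ _ _ (end₁-nbr e)

    end₂∈Y : ∀ e → Y (end₂ e) ≡ true
    end₂∈Y e = ∧-conicalʳ _ _ (end₂-nbr e)

  H : Multigraph
  H = record
    { k = Branch.size
    ; m = Subdiv.size
    ; ends = λ e → Branch.index (end₁ e) (end₁∈Y e) , Branch.index (end₂ e) (end₂∈Y e)
    ; noLoop = λ e same → end₁≢end₂ e (trans (≡.sym (Branch.element-index _ (end₁∈Y e)))
                                        (trans (cong Branch.element same) (Branch.element-index _ (end₂∈Y e)))) }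

  copy : RemovableCopy G H
  copy = record
    { φ = Branch.element
    ; ψ = coreVertex
    ; φ-inj = Branch.element-injective
    ; ψ-inj = Subdiv.element-injective
    ; disjoint = λ a e same → contradiction (trans (≡.sym (Y⊆big _ (Branch.element-sound a)))
                                                   (trans (cong big same) (small e))) λ ()
    ; edge₁ = λ e → subst (λ u → adj G (coreVertex e) u ≡ true) (≡.sym (Branch.element-index _ (end₁∈Y e)))
                          (∧-conicalˡ _ _ (end₁-nbr e))
    ; edge₂ = λ e → subst (λ u → adj G (coreVertex e) u ≡ true) (≡.sym (Branch.element-index _ (end₂∈Y e)))
                          (∧-conicalˡ _ _ (end₂-nbr e))
    ; coreRem = λ e → <⇒≤ (¬bigB⇒ G (small e)) , ≤-reflexive (⌊⌋⇒ (_ ℕ.≟ 2) (∧-conicalʳ _ _ (twoBigNbrs e)))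
    ; branchBig = λ a → bigB⇒ G (Y⊆big _ (Branch.element-sound a)) }

  inCore-copy : ∀ w → inCore copy w ≡ core Y w
  inCore-copy = image≡p subdivision

  degMinusCore-copy : ∀ v → degMinusCore copy v ≡ degOffCore Y v
  degMinusCore-copy v = count-cong (λ w → cong (λ b → adj G v w ∧ not b) (inCore-copy w))

  edges-copy : m H ≡ count (core Y)
  edges-copy = size≡count subdivision

  module _ (X : Fin Branch.size → Bool) where

    X̂ : V G → Bool
    X̂ = extend branch X

    count-extend : count X ≡ count X̂
    count-extend = sumFin-extend branch X (λ _ → 1)

    degMinusCore-extend : sumFin (λ a → when (X a) (degMinusCore copy (φ copy a)))
                        ≡ sumFin (λ v → when (X̂ v) (degOffCore Y v))
    degMinusCore-extend = trans (sumFin-cong (λ a → cong (when (X a)) (degMinusCore-copy (Branch.element a))))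
                                (sumFin-extend branch X (degOffCore Y))

    boundary-extend : boundary H X ≡ crossingCore Y X̂
    boundary-extend = begin
      boundary H X                                                     ≡⟨ count-cong (λ e → cong₂ _xor_ (X≡X̂ (end₁∈Y e)) (X≡X̂ (end₂∈Y e))) ⟩
      count (λ e → X̂ (end₁ e) xor X̂ (end₂ e))                          ≡⟨ count-cong X̂-nbrs ⟩
      sumFin (λ e → χ ⌊ nbrsIn G X̂ (coreVertex e) ℕ.≟ 1 ⌋)            ≡⟨ Subdiv.sumFin-element (λ w → χ ⌊ nbrsIn G X̂ w ℕ.≟ 1 ⌋) ⟩
      sumFin (λ w → when (core Y w) (χ ⌊ nbrsIn G X̂ w ℕ.≟ 1 ⌋))       ≡⟨ sumFin-cong (λ w → ≡.sym (χ-∧ˡ (core Y w) _)) ⟩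
      crossingCore Y X̂                                                 ∎
      where
      open ≡-Reasoning
      X≡X̂ : ∀ {u} (u∈Y : Y u ≡ true) → X (Branch.index u u∈Y) ≡ X̂ u
      X≡X̂ u∈Y = trans (≡.sym (extend-element branch X _)) (cong X̂ (Branch.element-index _ u∈Y))
      xor-χ : ∀ a b → (a xor b) ≡ ⌊ χ a + χ b ℕ.≟ 1 ⌋
      xor-χ true  true  = refl
      xor-χ true  false = refl
      xor-χ false true  = refl
      xor-χ false false = refl
      X̂-nbrs : ∀ e → (X̂ (end₁ e) xor X̂ (end₂ e)) ≡ ⌊ nbrsIn G X̂ (coreVertex e) ℕ.≟ 1 ⌋
      X̂-nbrs e = trans (xor-χ (X̂ (end₁ e)) (X̂ (end₂ e)))
                       (cong (λ c → ⌊ c ℕ.≟ 1 ⌋) (≡.sym (trans (count-cong onEnds) (count-pair (end₁≢end₂ e) X̂))))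
        where
        onEnds : ∀ u → (adj G (coreVertex e) u ∧ X̂ u) ≡ ((u == end₁ e ∨ u == end₂ e) ∧ X̂ u)
        onEnds u = trans inY (cong (_∧ X̂ u) (Y-nbrs≡ends e u))
          where
          inY : (adj G (coreVertex e) u ∧ X̂ u) ≡ ((adj G (coreVertex e) u ∧ Y u) ∧ X̂ u)
          inY with X̂ u in X̂u
          ... | false = trans (∧-zeroʳ _) (≡.sym (∧-zeroʳ _))
          ... | true rewrite extend-⊆ branch X u X̂u = ≡.sym (∧-identityʳ _)

GoodAt : ∀ {G H} → RemovableCopy G H → (Fin (k H) → Bool) → Set
GoodAt {G} {H} c X =
  (sumFin (λ a → when (X a) (degMinusCore c (φ c a))) ∸ boundary H X) ^ 10 ≤ count X ^ 10 * maxDeg G ^ 9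

GoodAt? : ∀ {G H} (c : RemovableCopy G H) X → Dec (GoodAt c X)
GoodAt? c X = _ ≤? _

GoodAt-resp : ∀ {G H} (c : RemovableCopy G H) {X Z} → (∀ a → X a ≡ Z a) → GoodAt c X → GoodAt c Z
GoodAt-resp {G} {H} c X≗Z = subst₂ _≤_
  (cong₂ (λ s b → (s ∸ b) ^ 10) (sumFin-cong (λ a → cong (λ x → when x (degMinusCore c (φ c a))) (X≗Z a)))
                                (count-cong (λ e → cong₂ _xor_ (X≗Z (proj₁ (ends H e))) (X≗Z (proj₂ (ends H e))))))
  (cong (λ c → c ^ 10 * maxDeg G ^ 9) (count-cong X≗Z))

-- Θ β exceeds 4 (β + 2) + β, the bound on Φ(big) / |big| that niceness provides.
Θ : ℕ → ℕ
Θ β = 4 * (β + 2) + β + 1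

module Main (G : Graph) (β : ℕ) (bound : ∀ B → eAB G B ≤ β * count B) where
  open Core G
  open Sparse G β bound

  θ : ℕ
  θ = Θ β

  module _ (17≤Δ : 17 ≤ maxDeg G) (θ¹⁰≤Δ : θ ^ 10 ≤ maxDeg G)
           (twoBig : ∀ w → big w ≡ false → 2 ≤ nbrsIn G big w) where

    big-nonempty : 1 ≤ count big
    big-nonempty with maxFin-attained (deg G) (≤-trans z<s 17≤Δ)
    ... | v , Δ≡deg = subst (1 ≤_) (≡.sym (count-remove big (⇒⌊⌋ (maxDeg G ≤? deg G v ^ 4) Δ≤deg⁴))) (s≤s z≤n)
      where
      deg>0 : 0 ℕ.< deg G v
      deg>0 = ≤-trans (≤-trans z<s 17≤Δ) (≤-reflexive Δ≡deg)
      Δ≤deg⁴ : maxDeg G ≤ deg G v ^ 4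
      Δ≤deg⁴ = ≤-trans (≤-reflexive Δ≡deg) (subst (_≤ deg G v ^ 4) (*-identityʳ (deg G v))
                                                  (^-monoʳ-≤ (deg G v) {{>-nonZero deg>0}} {1} {4} (s≤s z≤n)))

    Φ-big : Φ θ big ℕ.< θ * count big
    Φ-big = begin-strict
      Φ θ big                                            ≡⟨ cong (λ c → degSum + θ * c) none-outside ⟩
      degSum + θ * 0                                     ≡⟨ trans (cong (degSum +_) (*-zeroʳ θ)) (+-identityʳ degSum) ⟩
      degSum                                             ≤⟨ sumFin-mono pointwise ⟩
      sumFin (λ v → when (big v) (nbrsIn G big v) + when (big v) (nbrsIn G manyBig v))
        ≡⟨ sumFin-+ (λ v → when (big v) (nbrsIn G big v)) (λ v → when (big v) (nbrsIn G manyBig v)) ⟩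
      sumFin (λ v → when (big v) (nbrsIn G big v)) + sumFin (λ v → when (big v) (nbrsIn G manyBig v))
        ≡⟨ cong (sumFin (λ v → when (big v) (nbrsIn G big v)) +_) (sumFin-nbrsIn-swap G big manyBig) ⟩
      sumFin (λ v → when (big v) (nbrsIn G big v)) + eAB G big
        ≤⟨ +-mono-≤ (inducedDegreeSum≤ big) (bound big) ⟩
      4 * (β + 2) * count big + β * count big            ≡⟨ ≡.sym (*-distribʳ-+ (count big) (4 * (β + 2)) β) ⟩
      (4 * (β + 2) + β) * count big                      <⟨ *-monoˡ-< (count big) {{>-nonZero big-nonempty}} (n<1+n (4 * (β + 2) + β)) ⟩
      suc (4 * (β + 2) + β) * count big                  ≡⟨ cong (_* count big) (+-comm 1 (4 * (β + 2) + β)) ⟩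
      θ * count big                                      ∎
      where
      open ≤-Reasoning
      degSum : ℕ
      degSum = sumFin (λ v → when (big v) (degOffCore big v))
      manyBig : V G → Bool
      manyBig w = not (big w) ∧ ⌊ 3 ≤? nbrsIn G big w ⌋
      none-outside : count (big ∖ big) ≡ 0
      none-outside = trans (count-cong (λ v → ∧-inverseʳ (big v))) (sumFin-zero (n G))
      offCore : ∀ v → degOffCore big v ≤ nbrsIn G big v + nbrsIn G manyBig v
      offCore v = ≤-trans (sumFin-mono nbr)
        (≤-reflexive (sumFin-+ (λ w → χ (adj G v w ∧ big w)) (λ w → χ (adj G v w ∧ manyBig w))))
        where
        nbr : ∀ w → χ (adj G v w ∧ not (core big w)) ≤ χ (adj G v w ∧ big w) + χ (adj G v w ∧ manyBig w)
        nbr w with adj G v w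
        ... | false = z≤n
        ... | true with big w in bigw
        ...   | true = s≤s z≤n
        ...   | false with nbrsIn G big w ℕ.≟ 2 | 3 ≤? nbrsIn G big w
        ...     | yes _  | _     = z≤n
        ...     | no  _  | yes _ = ≤-refl
        ...     | no ≢2  | no ≱3 = contradiction (≤-antisym (≤-pred (≰⇒> ≱3)) (twoBig w bigw)) ≢2
      pointwise : ∀ v → when (big v) (degOffCore big v) ≤ when (big v) (nbrsIn G big v) + when (big v) (nbrsIn G manyBig v)
      pointwise v with big v
      ... | true  = offCore v
      ... | false = z≤n

    θ≤deg : ∀ {v} → big v ≡ true → θ ≤ deg G v
    θ≤deg {v} isBig with θ ≤? deg G v
    ... | yes θ≤ = θ≤
    ... | no  θ≰ = contradiction (≤-trans (^-monoˡ-< 4 (≰⇒> θ≰)) (≤-trans θ⁴≤Δ (bigB⇒ G isBig))) (n≮n (deg G v ^ 4))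
      where
      θ⁴≤Δ : θ ^ 4 ≤ maxDeg G
      θ⁴≤Δ = ≤-trans (^-monoʳ-≤ θ {{>-nonZero (m≤n+m 1 (4 * (β + 2) + β))}} {4} {10} (s≤s (s≤s (s≤s (s≤s z≤n))))) θ¹⁰≤Δ

    -- With an empty core, every vertex of Y contributes its full degree, at least θ, to Φ.
    core-nonempty : ∀ {Y} → Y ⊆ big → Φ θ Y ℕ.< θ * count big → 1 ≤ count (core Y)
    core-nonempty {Y} Y⊆big Φ< with count (core Y) in |core|
    ... | suc _  = s≤s z≤n
    ... | ℕ.zero = contradiction Φ< (≤⇒≯ θ|big|≤Φ)
      where
      open ≤-Reasoning
      offCore≡deg : ∀ v → degOffCore Y v ≡ deg G v
      offCore≡deg v = count-cong λ w → trans (cong (λ b → adj G v w ∧ not b) (count≡0⇒false (core Y) |core| w)) (∧-identityʳ _)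
      θ≤offCore : ∀ v → when (Y v) θ ≤ when (Y v) (degOffCore Y v)
      θ≤offCore v with Y v in Yv
      ... | true  = ≤-trans (θ≤deg (Y⊆big v Yv)) (≤-reflexive (≡.sym (offCore≡deg v)))
      ... | false = z≤n
      θ|big|≤Φ : θ * count big ≤ Φ θ Y
      θ|big|≤Φ = begin
        θ * count big                                   ≡⟨ cong (θ *_) (trans (sumFin-when-∖ Y⊆big (λ _ → 1)) (+-comm _ (count Y))) ⟩
        θ * (count Y + count (big ∖ Y))                 ≡⟨ *-distribˡ-+ θ (count Y) (count (big ∖ Y)) ⟩
        θ * count Y + θ * count (big ∖ Y)               ≡⟨ cong (_+ θ * count (big ∖ Y)) (≡.sym (sumFin-when Y θ)) ⟩
        sumFin (λ v → when (Y v) θ) + θ * count (big ∖ Y) ≤⟨ +-monoˡ-≤ _ (sumFin-mono θ≤offCore) ⟩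
        Φ θ Y                                           ∎

    ¬GoodAt⇒Φ-decreases : ∀ Y (Y⊆big : Y ⊆ big) X → ¬ GoodAt (Copy.copy G Y Y⊆big) X →
      Φ θ (Y ∖ Copy.X̂ G Y Y⊆big X) ℕ.< Φ θ Y
    ¬GoodAt⇒Φ-decreases Y Y⊆big X bad = Φ-∖ θ (extend-⊆ branch X) Y⊆big
      (subst₂ ℕ._<_ (cong₂ (λ c b → θ * c + b) (count-extend X) (boundary-extend X)) (degMinusCore-extend X)
              (¬≤Δ^[9/10]⇒ θ (sumFin (λ a → when (X a) (degMinusCore copy (φ copy a)))) (boundary H X) (count X) θ¹⁰≤Δ bad))
      where open Copy G Y Y⊆big

    descend : ∀ fuel Y → Y ⊆ big → Φ θ Y ℕ.< θ * count big → Φ θ Y ℕ.< fuel → OutcomeB G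
    descend (suc fuel) Y Y⊆big Φ< Φ<fuel =
      [ stop , continue ]′ (all-or-counterexample (GoodAt copy) (GoodAt? copy) (GoodAt-resp copy))
      where
      open Copy G Y Y⊆big
      stop : (∀ X → GoodAt copy X) → OutcomeB G
      stop good = H , subst (1 ≤_) (≡.sym edges-copy) (core-nonempty Y⊆big Φ<) , copy , good
      continue : Σ (Fin (k H) → Bool) (λ X → ¬ GoodAt copy X) → OutcomeB G
      continue (X , bad) =
        descend fuel (Y ∖ X̂ X) (λ v v∈ → Y⊆big v (∧-conicalˡ _ _ v∈))
                (<-trans smaller Φ<) (<-≤-trans smaller (≤-pred Φ<fuel))
        where
        smaller : Φ θ (Y ∖ X̂ X) ℕ.< Φ θ Y
        smaller = ¬GoodAt⇒Φ-decreases Y Y⊆big X bad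

    outcomeB : OutcomeB G
    outcomeB = descend (suc (Φ θ big)) big (λ _ isBig → isBig) Φ-big ≤-refl

  outcome : Θ β ^ 10 + 17 ≤ maxDeg G → OutcomeA G ⊎ OutcomeB G
  outcome large with Finₚ.any? (λ w → (big w Boolₚ.≟ false) ×-dec (nbrsIn G big w ≤? 1))
  ... | yes (w , small , ≤1) = inj₁ (outcomeA G 17≤Δ w small ≤1)
    where
    17≤Δ : 17 ≤ maxDeg G
    17≤Δ = ≤-trans (m≤n+m 17 _) large
  ... | no ∄ = inj₂ (outcomeB (≤-trans (m≤n+m 17 _) large) (≤-trans (m≤m+n _ 17) large) twoBig)
    where
    twoBig : ∀ w → big w ≡ false → 2 ≤ nbrsIn G big w
    twoBig w small with nbrsIn G big w ≤? 1
    ... | yes ≤1 = contradiction (w , small , ≤1) ∄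
    ... | no  ≰1 = ≰⇒> ≰1

-- ε does not occur in the outcomes, so one threshold serves every ε.
lemma3p3 : (F : Graph → Set) → Nice F → (ε : ℚ) → 0ℚ < ε →
    ∃[ Δε ] (∀ (G : Graph) → F G → Δε ≤ maxDeg G → OutcomeA G ⊎ OutcomeB G)
lemma3p3 F nice _ _ = Θ β ^ 10 + 17 , λ G G∈F → Main.outcome G β (bound G G∈F)
  where open Nice nice
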